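{- Let $H$ be the black saturation of $\langle G,\pi_b\rangle$ under the standing assumptions of the context, with black path $P=(b_1,\dots,b_m)$. Let $h_1,\dots,h_p$ be the rb-trivial blocks of $H$ and let the other (non-rb-trivial) blocks be $q$ in number. Then the non-rb-trivial blocks can be labeled $H^-_1,\dots,H^-_q$ so that the block-cut-vertex tree $T$ of $H$ consists of: (1) a path $Q=(H^-_1,b_{\gamma(1)},H^-_2,b_{\gamma(2)},\dots,H^-_{q-1},b_{\gamma(q-1)},H^-_q)$, where $1<\gamma(1)<\gamma(2)<\dots<\gamma(q-1)<m$, that contains all non-rb-trivial blocks of $H$ and no rb-trivial block, such that $H^-_1$ contains the subpath of $P$ between $b_1$ and $b_{\gamma(1)}$, for $j=2,\dots,q-1$ the block $H^-_j$ contains the subpath of $P$ between $b_{\gamma(j-1)}$ and $b_{\gamma(j)}$, and $H^-_q$ contains the subpath of $P$ between $b_{\gamma(q-1)}$ and $b_m$; and (2) a set of leaves representing $h_1,\dots,h_p$, where for each rb-trivial block $h_x=(b_i,r_h)$ the black vertex $b_i$ either belongs to a single non-rb-trivial block $H^-_j$ (and then $T$ contains a node $b_i$ adjacent to $H^-_j$, and the leaf representing $h_x$ is adjacent to $b_i$), or belongs to two non-rb-trivial blocks $H^-_j$ and $H^-_{j+1}$ (and then the leaf representing $h_x$ is adjacent to $b_i=b_{\gamma(j)}$).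
   Context: $G=(V_b,V_r,E)$ is a bipartite planar graph (black vertices $V_b$, red vertices $V_r$), $\pi_b=\langle b_1,\dots,b_m\rangle$ is a linear ordering of $V_b$, $P=(b_1,\dots,b_m)$ is the black path and $H=(V_b,V_r,E\cup E(P))$ is the black saturation. Standing assumptions: $H$ is planar; every black vertex of $H$ has a red neighbor and every red vertex has a black neighbor (so $H$ is connected); $H$ has at least three black and three red vertices. A block is a maximal biconnected subgraph; a block is rb-trivial if it consists of a single edge between a red and a black vertex. The block-cut-vertex tree of a connected graph has a node for each block and each cut-vertex, a block being adjacent to the cut-vertices it contains. -}

module Defs where

open import Data.Nat using (ℕ; zero; suc; _≤_; _<_; _∸_; _+_; _*_; _≡ᵇ_)
open import Data.Fin using (Fin; toℕ; inject₁) renaming (zero to fzero; suc to fsuc)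
open import Data.Fin.Subset using (Subset) renaming (_∈_ to _∈ₛ_)
open import Data.Bool using (Bool; true; false; T; _∨_)
open import Data.Bool.Properties using (∨-comm)
open import Data.Sum using (_⊎_; inj₁; inj₂)
open import Data.Product using (Σ; ∃; ∃-syntax; _×_; _,_)
open import Data.Empty using (⊥)
open import Data.List using (List; length)
open import Data.List.Membership.Propositional using (_∈_)
open import Data.List.Relation.Unary.AllPairs using (AllPairs)
open import Data.List.Relation.Unary.Unique.Propositional using (Unique)
open import Relation.Nullary using (¬_)
open import Relation.Binary.PropositionalEquality using (_≡_; _≢_; subst)
open import Function using (_∘_)

-- Black vertices b_1,…,b_m are  inj₁ i  with  i : Fin m  (b_k ↔ index k-1);
-- the linear order π_b is the order of the indices.

Vtx : ℕ → ℕ → Set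
Vtx m n = Fin m ⊎ Fin n

iter : ∀ {A : Set} → ℕ → (A → A) → A → A
iter zero    f x = x
iter (suc k) f x = f (iter k f x)

SameOrbit : ∀ {A : Set} → (A → A) → A → A → Set
SameOrbit f x y = ∃[ k ] iter k f x ≡ y

module _ {m n : ℕ} (E : Fin m → Fin n → Bool) where

  -- adjacency of the black saturation H = (V_b, V_r, E ∪ E(P))
  adjH : Vtx m n → Vtx m n → Bool
  adjH (inj₁ i) (inj₁ j) = (toℕ j ≡ᵇ suc (toℕ i)) ∨ (toℕ i ≡ᵇ suc (toℕ j))
  adjH (inj₁ i) (inj₂ r) = E i r
  adjH (inj₂ r) (inj₁ i) = E i r
  adjH (inj₂ _) (inj₂ _) = false

  adjH-sym : ∀ u v → T (adjH u v) → T (adjH v u)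
  adjH-sym (inj₁ i) (inj₁ j) p =
    subst T (∨-comm (toℕ j ≡ᵇ suc (toℕ i)) (toℕ i ≡ᵇ suc (toℕ j))) p
  adjH-sym (inj₁ i) (inj₂ r) p = p
  adjH-sym (inj₂ r) (inj₁ i) p = p
  adjH-sym (inj₂ _) (inj₂ _) ()

  -- Planarity of H (combinatorial definition: H is connected under the
  -- standing assumptions; a connected graph is planar iff it has a
  -- rotation system (combinatorial map) of genus 0, i.e. V − E + F = 2,
  -- where F is the number of orbits of the face permutation).

  record Dart : Set where
    constructor dart
    field
      src tgt : Vtx m n
      isEdge  : T (adjH src tgt)

  rev : Dart → Dart
  rev (dart u v p) = dart v u (adjH-sym u v p)

  record RotationSystem : Set where
    field
      σ σ⁻¹    : Dart → Dart
      σσ⁻¹     : ∀ d → σ (σ⁻¹ d) ≡ d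
      σ⁻¹σ     : ∀ d → σ⁻¹ (σ d) ≡ d
      σ-src    : ∀ d → Dart.src (σ d) ≡ Dart.src d
      σ-cyclic : ∀ d d' → Dart.src d ≡ Dart.src d' → SameOrbit σ d d'

    face : Dart → Dart
    face = σ ∘ rev

  record GenusZeroEmbedding : Set where
    field
      rot      : RotationSystem
      darts    : List Dart
      darts-unique   : Unique darts
      darts-complete : ∀ d → d ∈ darts
      faces    : List Dart
      faces-cover    : ∀ d → ∃[ f ] (f ∈ faces × SameOrbit (RotationSystem.face rot) f d)
      faces-distinct : AllPairs (λ f f' → ¬ SameOrbit (RotationSystem.face rot) f f') faces
      -- Euler: |V| − |E| + |F| = 2, with |E| = |darts| / 2
      euler    : 2 * (m + n) + 2 * length faces ≡ length darts + 4

  HPlanar : Set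
  HPlanar = GenusZeroEmbedding

  data WalkIn (A : Vtx m n → Set) : Vtx m n → Vtx m n → Set where
    here : ∀ {v} → A v → WalkIn A v v
    step : ∀ {u v w} → A u → T (adjH u v) → WalkIn A v w → WalkIn A u w

  ConnectedOn : (Vtx m n → Set) → Set
  ConnectedOn A = ∀ u v → A u → A v → WalkIn A u v

  VSet : Set
  VSet = Subset m × Subset n

  _∈ᵛ_ : Vtx m n → VSet → Set
  inj₁ i ∈ᵛ (B , R) = i ∈ₛ B
  inj₂ r ∈ᵛ (B , R) = r ∈ₛ R

  _⊆ᵛ_ : VSet → VSet → Set
  S ⊆ᵛ S' = ∀ v → v ∈ᵛ S → v ∈ᵛ S'

  Biconnected : VSet → Set
  Biconnected S =
    (∃[ u ] ∃[ v ] (u ∈ᵛ S × v ∈ᵛ S × u ≢ v)) ×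
    ConnectedOn (_∈ᵛ S) ×
    (∀ x → x ∈ᵛ S → ConnectedOn (λ v → v ∈ᵛ S × v ≢ x))

  -- a block: a maximal biconnected subgraph (given by its vertex set;
  -- maximal biconnected subgraphs are induced)
  Block : VSet → Set
  Block S = Biconnected S × (∀ S' → Biconnected S' → S ⊆ᵛ S' → S' ⊆ᵛ S)

  RbTrivialAt : VSet → Fin m → Fin n → Set
  RbTrivialAt S i r =
    inj₁ i ∈ᵛ S × inj₂ r ∈ᵛ S × (∀ v → v ∈ᵛ S → v ≡ inj₁ i ⊎ v ≡ inj₂ r)

  RbTrivial : VSet → Set
  RbTrivial S = ∃[ i ] ∃[ r ] RbTrivialAt S i r

  CutVertex : Vtx m n → Set
  CutVertex x = ∃[ u ] ∃[ v ] (u ≢ x × v ≢ x × ¬ WalkIn (λ w → w ≢ x) u v)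

  -- adjacency of the block-cut-vertex tree T of H: its nodes are the
  -- blocks and the cut vertices, a block S being adjacent to cut vertex v
  -- iff v ∈ S
  BCAdj : VSet → Vtx m n → Set
  BCAdj S v = Block S × CutVertex v × v ∈ᵛ S

  -- Endpoints (0-based indices into P) of the subpath of P contained in
  -- H⁻_j:  lo j = index of b_{γ(j-1)} (b_1 for j = 1),
  --        hi j = index of b_{γ(j)}   (b_m for j = q).

  loP : ∀ {q'} → (Fin q' → Fin m) → Fin (suc q') → ℕ
  loP γ fzero    = 0
  loP γ (fsuc k) = toℕ (γ k)

  hiP : ∀ {q'} → (Fin q' → Fin m) → Fin (suc q') → ℕ
  hiP {zero}   γ fzero    = m ∸ 1
  hiP {suc q'} γ fzero    = toℕ (γ fzero)
  hiP {suc q'} γ (fsuc j) = hiP (γ ∘ fsuc) j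

  -- The conclusion of Lemma 11.  q = suc q'; H⁻ j is H⁻_{j+1};
  -- γ k is the 0-based index of b_{γ(k+1)}.

  record BlockCutStructure : Set where
    field
      q'   : ℕ
      H⁻   : Fin (suc q') → VSet
      γ    : Fin q' → Fin m

      H⁻-block    : ∀ j → Block (H⁻ j)
      H⁻-nontriv  : ∀ j → ¬ RbTrivial (H⁻ j)
      H⁻-injective : ∀ j j' → H⁻ j ≡ H⁻ j' → j ≡ j'
      H⁻-onto     : ∀ S → Block S → ¬ RbTrivial S → ∃[ j ] H⁻ j ≡ S

      γ-lower : ∀ k → 0 < toℕ (γ k)
      γ-upper : ∀ k → suc (toℕ (γ k)) < m
      γ-mono  : ∀ k k' → toℕ k < toℕ k' → toℕ (γ k) < toℕ (γ k')

      Q-path  : ∀ k → BCAdj (H⁻ (inject₁ k)) (inj₁ (γ k))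
                    × BCAdj (H⁻ (fsuc k)) (inj₁ (γ k))
      -- H⁻_j contains the subpath of P between b_{γ(j-1)} and b_{γ(j)}
      -- (with b_{γ(0)} := b_1, b_{γ(q)} := b_m); blocks are induced, so
      -- containing the vertices means containing the subpath
      subpath : ∀ j (i : Fin m) → loP γ j ≤ toℕ i → toℕ i ≤ hiP γ j
                  → inj₁ i ∈ᵛ H⁻ j

      leaves  : ∀ S i r → Block S → RbTrivialAt S i r →
                  BCAdj S (inj₁ i) ×
                  (∀ v → BCAdj S v → v ≡ inj₁ i) ×
                  ( (∃[ j ] ( inj₁ i ∈ᵛ H⁻ j
                            × (∀ j' → inj₁ i ∈ᵛ H⁻ j' → j' ≡ j)
                            × BCAdj (H⁻ j) (inj₁ i)))
                  ⊎ (∃[ k ] ( i ≡ γ k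
                            × inj₁ i ∈ᵛ H⁻ (inject₁ k)
                            × inj₁ i ∈ᵛ H⁻ (fsuc k)
                            × (∀ j' → inj₁ i ∈ᵛ H⁻ j' → j' ≡ inject₁ k ⊎ j' ≡ fsuc k))))

      -- T consists only of the above: every edge of T at a non-rb-trivial
      -- block is an edge of Q or an edge H⁻_j — b_i towards a node b_i
      -- lying only in H⁻_j and carrying rb-trivial blocks
      -- (edges at rb-trivial blocks are described by 'leaves').
      no-other-edges : ∀ j v → BCAdj (H⁻ j) v →
                  (∃[ k ] (v ≡ inj₁ (γ k) × (j ≡ inject₁ k ⊎ j ≡ fsuc k)))
                  ⊎ (∃[ i ] ( v ≡ inj₁ i
                            × (∀ j' → inj₁ i ∈ᵛ H⁻ j' → j' ≡ j)
                            × ∃[ S ] ∃[ r ] (Block S × RbTrivialAt S i r)))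

-- For a red vertex r let lo r and hi r be its first and last black neighbour on P; r spans the
-- indices strictly between them.  An inner index g spanned by no red vertex is a gap: an edge of
-- H avoiding b_g never crosses g, so b_g is a cut vertex and no biconnected subgraph has vertices
-- on both sides of it.  The gaps cut P into segments, and a segment together with the red
-- vertices having at least two neighbours, all inside it, is biconnected, since each interior
-- black vertex is bypassed through a red vertex spanning it.  These are the non-rb-trivial
-- blocks.  A red vertex with a single neighbour b_i forms an rb-trivial block and makes b_i a cut
-- vertex; no other vertex is a cut vertex.

module Submission where

open import Data.Nat using (ℕ; zero; suc; pred; _≤_; _<_; _∸_; _+_; z≤n; s≤s; s≤s⁻¹; _≤?_; _<?_; _≟_; >-nonZero)
open import Data.Nat.Properties
open import Data.Fin using (Fin; toℕ; fromℕ<; fromℕ; inject₁) renaming (zero to fzero; suc to fsuc; _≟_ to _≟ᶠ_)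
open import Data.Fin.Properties
  using (toℕ-injective; toℕ<n; toℕ-fromℕ<; toℕ-fromℕ; toℕ-inject₁; any?)
  renaming (suc-injective to fsuc-injective)
open import Data.Fin.Subset using (Subset; ⁅_⁆) renaming (_∈_ to _∈ₛ_)
open import Data.Fin.Subset.Properties using (x∈⁅x⁆; x∈⁅y⁆⇒x≡y; ⊆-antisym) renaming (_∈?_ to _∈ₛ?_)
open import Data.Bool using (Bool; T; T?)
open import Data.Bool.Properties using (T-∨; T-≡)
open import Data.Empty using (⊥; ⊥-elim)
open import Data.Sum using (_⊎_; inj₁; inj₂; map₁; [_,_]′)
open import Data.Sum.Properties using (≡-dec; inj₁-injective)
open import Data.Product using (Σ; ∃-syntax; _×_; _,_; proj₁; proj₂; map₂; swap)
open import Data.Vec using (tabulate)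
open import Data.Vec.Properties using (lookup⇒[]=; []=⇒lookup; lookup∘tabulate)
open import Data.List using (List; _∷_; length; filter; allFin; lookup)
import Data.List.Relation.Unary.All as All
open import Data.List.Relation.Unary.AllPairs using (AllPairs; _∷_)
open import Data.List.Relation.Unary.AllPairs.Properties using (tabulate⁺-<; filter⁺)
open import Data.List.Relation.Unary.Any using (index)
open import Data.List.Relation.Unary.Any.Properties using (lookup-index)
open import Data.List.Membership.Propositional using () renaming (_∈_ to _∈ˡ_)
open import Data.List.Membership.Propositional.Properties using (∈-filter⁺; ∈-filter⁻; ∈-lookup; ∈-allFin)
open import Data.Fin.Relation.Unary.Top using (view; ‵fromℕ; ‵inject₁)
open import Relation.Nullary using (¬_; Dec; yes; no)
open import Relation.Nullary.Decidable using (_×-dec_; ¬?; ⌊_⌋; fromWitness; toWitness)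
open import Relation.Binary.PropositionalEquality
open import Relation.Binary.Definitions using (tri<; tri≈; tri>)
open import Function using (_∘_; _∋_; Equivalence)
open import Defs

pattern black i = inj₁ i
pattern red r = inj₂ r

least : ∀ {k} {P : Fin k → Set} → (∀ i → Dec (P i)) → ∃[ i ] P i →
        Σ (Fin k) λ i → P i × (∀ j → P j → toℕ i ≤ toℕ j)
least {suc k} P? w with P? fzero | w
... | yes p0 | _ = fzero , p0 , λ _ _ → z≤n
... | no ¬p0 | (fzero , p0) = ⊥-elim (¬p0 p0)
... | no ¬p0 | (fsuc i , pi) with least (P? ∘ fsuc) (i , pi)
...   | (l , pl , l-least) = fsuc l , pl , λ
          { fzero pj → ⊥-elim (¬p0 pj)
          ; (fsuc j) pj → s≤s (l-least j pj) }

greatest : ∀ {k} {P : Fin k → Set} → (∀ i → Dec (P i)) → ∃[ i ] P i →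
           Σ (Fin k) λ i → P i × (∀ j → P j → toℕ j ≤ toℕ i)
greatest {suc k} P? w with any? (P? ∘ fsuc) | w
... | yes tail | _ with greatest (P? ∘ fsuc) tail
...   | (g , pg , g-greatest) = fsuc g , pg , λ
          { fzero _ → z≤n
          ; (fsuc j) pj → s≤s (g-greatest j pj) }
greatest {suc k} P? w | no none | (fzero , p0) = fzero , p0 , λ
          { fzero _ → z≤n
          ; (fsuc j) pj → ⊥-elim (none (j , pj)) }
greatest {suc k} P? w | no none | (fsuc i , pi) = ⊥-elim (none (i , pi))

select : ∀ {k} {P : Fin k → Set} → (∀ i → Dec (P i)) → Subset k
select P? = tabulate (λ i → ⌊ P? i ⌋)

select⁺ : ∀ {k} {P : Fin k → Set} (P? : ∀ i → Dec (P i)) {i} → P i → i ∈ₛ select P?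
select⁺ P? {i} p =
  lookup⇒[]= i _ (trans (lookup∘tabulate _ i) (Equivalence.to T-≡ (fromWitness p)))

select⁻ : ∀ {k} {P : Fin k → Set} (P? : ∀ i → Dec (P i)) {i} → i ∈ₛ select P? → P i
select⁻ P? {i} p =
  toWitness (Equivalence.from T-≡ (trans (sym (lookup∘tabulate _ i)) ([]=⇒lookup p)))

allPairs-lookup : ∀ {A : Set} {R : A → A → Set} {xs : List A} → AllPairs R xs →
  ∀ i j → toℕ i < toℕ j → R (lookup xs i) (lookup xs j)
allPairs-lookup (x~xs ∷ _) fzero (fsuc j) _ = All.lookup x~xs (∈-lookup j)
allPairs-lookup (_ ∷ xs!) (fsuc i) (fsuc j) i<j = allPairs-lookup xs! i j (s≤s⁻¹ i<j)

module Walks {m n : ℕ} (E : Fin m → Fin n → Bool) where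

  Walk : (Vtx m n → Set) → Vtx m n → Vtx m n → Set
  Walk = WalkIn E

  Adj : Vtx m n → Vtx m n → Set
  Adj u v = T (adjH E u v)

  path-adj⁻ : ∀ i j → Adj (black i) (black j) → toℕ j ≡ suc (toℕ i) ⊎ toℕ i ≡ suc (toℕ j)
  path-adj⁻ i j e with Equivalence.to T-∨ e
  ... | inj₁ p = inj₁ (≡ᵇ⇒≡ _ _ p)
  ... | inj₂ p = inj₂ (≡ᵇ⇒≡ _ _ p)

  path-adj⁺ : ∀ i j → toℕ j ≡ suc (toℕ i) → Adj (black i) (black j)
  path-adj⁺ i j eq = Equivalence.from T-∨ (inj₁ (≡⇒≡ᵇ _ _ eq))

  adj-irrefl : ∀ v → ¬ Adj v v
  adj-irrefl (black i) e with path-adj⁻ i i e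
  ... | inj₁ eq = <-irrefl eq (n<1+n _)
  ... | inj₂ eq = <-irrefl eq (n<1+n _)
  adj-irrefl (red r) ()

  walk-head : ∀ {A u v} → Walk A u v → A u
  walk-head (here a) = a
  walk-head (step a _ _) = a

  infixr 5 _++ʷ_
  _++ʷ_ : ∀ {A u v w} → Walk A u v → Walk A v w → Walk A u w
  here _ ++ʷ q = q
  step a e p ++ʷ q = step a e (p ++ʷ q)

  edgeʷ : ∀ {A u v} → A u → A v → Adj u v → Walk A u v
  edgeʷ au av e = step au e (here av)

  reverseʷ : ∀ {A u v} → Walk A u v → Walk A v u
  reverseʷ (here a) = here a
  reverseʷ {u = u} (step a e p) = reverseʷ p ++ʷ edgeʷ (walk-head p) a (adjH-sym E u _ e)

  mapʷ : ∀ {A B : Vtx m n → Set} {u v} → (∀ x → A x → B x) → Walk A u v → Walk B u v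
  mapʷ f (here a) = here (f _ a)
  mapʷ f (step a e p) = step (f _ a) e (mapʷ f p)

  transport : ∀ {A : Vtx m n → Set} (C : Vtx m n → Set) →
    (∀ {x y} → A x → A y → C x → Adj x y → C y) →
    ∀ {u v} → Walk A u v → C u → C v
  transport C closed (here _) c = c
  transport C closed (step a e p) c = transport C closed p (closed a (walk-head p) c e)

  connected-through : ∀ {A : Vtx m n → Set} h → (∀ v → A v → Walk A v h) → ConnectedOn E A
  connected-through h to-h u v au av = to-h u au ++ʷ reverseʷ (to-h v av)

  via-nbr : ∀ {A : Vtx m n → Set} {h} r k → A (red r) → T (E k r) → Walk A (black k) h → Walk A (red r) h
  via-nbr r k r∈A e w = edgeʷ r∈A (walk-head w) e ++ʷ w

  first-edge : ∀ {A u v} → Walk A u v → u ≢ v → ∃[ w ] (A u × A w × Adj u w)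
  first-edge (here _) u≢v = ⊥-elim (u≢v refl)
  first-edge (step a e p) _ = _ , a , walk-head p , e

  ascending : ∀ (A : Vtx m n → Set) d (i j : Fin m) → toℕ j ≡ toℕ i + d →
    (∀ t → toℕ i ≤ toℕ t → toℕ t ≤ toℕ j → A (black t)) → Walk A (black i) (black j)
  ascending A zero i j j≡i all =
    subst (λ k → Walk A (black k) (black j)) (toℕ-injective (trans j≡i (+-identityʳ _)))
      (here (all j (≤-reflexive (sym (trans j≡i (+-identityʳ _)))) ≤-refl))
  ascending A (suc d) i j j≡i all =
    step (all i ≤-refl i≤j) (path-adj⁺ i next (toℕ-fromℕ< next<m))
      (ascending A d next j (trans j≡i (trans (+-suc _ d) (cong (_+ d) (sym (toℕ-fromℕ< next<m)))))
         (λ t next≤t t≤j → all t (≤-trans (n≤1+n _) (subst (_≤ toℕ t) (toℕ-fromℕ< next<m) next≤t)) t≤j))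
    where
      i≤j : toℕ i ≤ toℕ j
      i≤j = subst (toℕ i ≤_) (sym j≡i) (m≤m+n _ _)
      next<m : suc (toℕ i) < m
      next<m = ≤-<-trans (subst (suc (toℕ i) ≤_) (trans (sym (+-suc _ d)) (sym j≡i)) (s≤s (m≤m+n _ d)))
                         (toℕ<n j)
      next : Fin m
      next = fromℕ< next<m

  upward : ∀ (A : Vtx m n → Set) (i j : Fin m) → toℕ i ≤ toℕ j →
    (∀ t → toℕ i ≤ toℕ t → toℕ t ≤ toℕ j → A (black t)) → Walk A (black i) (black j)
  upward A i j i≤j = ascending A (toℕ j ∸ toℕ i) i j (sym (m+[n∸m]≡n i≤j))

  segment : ∀ (A : Vtx m n → Set) (l h : ℕ) → (∀ t → l ≤ toℕ t → toℕ t ≤ h → A (black t)) →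
    ∀ i j → l ≤ toℕ i → toℕ i ≤ h → l ≤ toℕ j → toℕ j ≤ h → Walk A (black i) (black j)
  segment A l h all i j li ih lj jh with ≤-total (toℕ i) (toℕ j)
  ... | inj₁ i≤j = upward A i j i≤j (λ t it tj → all t (≤-trans li it) (≤-trans tj jh))
  ... | inj₂ j≤i = reverseʷ (upward A j i j≤i (λ t jt ti → all t (≤-trans lj jt) (≤-trans ti ih)))

module Separation {m n : ℕ} (E : Fin m → Fin n → Bool) (red-nbr : ∀ r → ∃[ i ] T (E i r)) where
  open Walks E public

  lo hi : Fin n → Fin m
  lo r = proj₁ (least (λ i → T? (E i r)) (red-nbr r))
  hi r = proj₁ (greatest (λ i → T? (E i r)) (red-nbr r))

  lo-adj : ∀ r → T (E (lo r) r)
  lo-adj r = proj₁ (proj₂ (least (λ i → T? (E i r)) (red-nbr r)))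

  hi-adj : ∀ r → T (E (hi r) r)
  hi-adj r = proj₁ (proj₂ (greatest (λ i → T? (E i r)) (red-nbr r)))

  lo-least : ∀ r i → T (E i r) → toℕ (lo r) ≤ toℕ i
  lo-least r = proj₂ (proj₂ (least (λ i → T? (E i r)) (red-nbr r)))

  hi-greatest : ∀ r i → T (E i r) → toℕ i ≤ toℕ (hi r)
  hi-greatest r = proj₂ (proj₂ (greatest (λ i → T? (E i r)) (red-nbr r)))

  lo≤hi : ∀ r → toℕ (lo r) ≤ toℕ (hi r)
  lo≤hi r = hi-greatest r (lo r) (lo-adj r)

  Pendant Spread : Fin n → Set
  Pendant r = lo r ≡ hi r
  Spread r = toℕ (lo r) < toℕ (hi r)

  pendant-or-spread : ∀ r → Pendant r ⊎ Spread r
  pendant-or-spread r with toℕ (lo r) <? toℕ (hi r)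
  ... | yes lo<hi = inj₂ lo<hi
  ... | no lo≮hi = inj₁ (toℕ-injective (≤-antisym (lo≤hi r) (≮⇒≥ lo≮hi)))

  spread⇒¬pendant : ∀ {r} → Spread r → ¬ Pendant r
  spread⇒¬pendant lo<hi lo≡hi = <-irrefl (cong toℕ lo≡hi) lo<hi

  pendant-nbr : ∀ r i → Pendant r → T (E i r) → i ≡ lo r
  pendant-nbr r i lo≡hi e = toℕ-injective (≤-antisym
    (subst (λ h → toℕ i ≤ toℕ h) (sym lo≡hi) (hi-greatest r i e)) (lo-least r i e))

  Spans : Fin n → ℕ → Set
  Spans r p = toℕ (lo r) < p × p < toℕ (hi r)

  Spanned : ℕ → Set
  Spanned p = ∃[ r ] Spans r p

  spanned? : ∀ p → Dec (Spanned p)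
  spanned? p = any? (λ r → (toℕ (lo r) <? p) ×-dec (p <? toℕ (hi r)))

  -- The paper's b_{γ(1)}, …, b_{γ(q-1)} are the b_g with Gap g.
  Gap : Fin m → Set
  Gap g = 0 < toℕ g × suc (toℕ g) < m × ¬ Spanned (toℕ g)

  gap? : ∀ g → Dec (Gap g)
  gap? g = (0 <? toℕ g) ×-dec ((suc (toℕ g) <? m) ×-dec ¬? (spanned? (toℕ g)))

  ¬gap : ∀ g → ¬ Gap g → toℕ g ≡ 0 ⊎ suc (toℕ g) ≡ m ⊎ Spanned (toℕ g)
  ¬gap g not-gap with 0 <? toℕ g | suc (toℕ g) <? m | spanned? (toℕ g)
  ... | no g≯0 | _ | _ = inj₁ (n≤0⇒n≡0 (≮⇒≥ g≯0))
  ... | yes _ | no 1+g≮m | _ = inj₂ (inj₁ (≤-antisym (toℕ<n g) (≮⇒≥ 1+g≮m)))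
  ... | yes _ | yes _ | yes spanned = inj₂ (inj₂ spanned)
  ... | yes 0<g | yes 1+g<m | no unspanned = ⊥-elim (not-gap (0<g , 1+g<m , unspanned))

  RightOf : ℕ → Vtx m n → Set
  RightOf p (black k) = p < toℕ k
  RightOf p (red r) = p < toℕ (hi r)

  black≢ : ∀ {i j : Fin m} → toℕ i ≢ toℕ j → black i ≢ (Vtx m n ∋ black j)
  black≢ i≢j refl = i≢j refl

  rightOf-closed : ∀ g → ¬ Spanned (toℕ g) → ∀ {x y} → x ≢ black g → y ≢ black g →
    RightOf (toℕ g) x → Adj x y → RightOf (toℕ g) y
  rightOf-closed g _ {black k} {black k′} _ k′≢g g<k e with path-adj⁻ k k′ e
  ... | inj₁ k′≡1+k = subst (toℕ g <_) (sym k′≡1+k) (m<n⇒m<1+n g<k)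
  ... | inj₂ k≡1+k′ = ≤∧≢⇒< (≤-pred (subst (toℕ g <_) k≡1+k′ g<k))
                             (λ g≡k′ → k′≢g (cong black (toℕ-injective (sym g≡k′))))
  rightOf-closed g _ {black k} {red r} _ _ g<k e = <-≤-trans g<k (hi-greatest r k e)
  rightOf-closed g unspanned {red r} {black k} _ k≢g g<hi e with toℕ (lo r) <? toℕ g
  ... | yes lo<g = ⊥-elim (unspanned (r , lo<g , g<hi))
  ... | no lo≮g = ≤∧≢⇒< (≤-trans (≮⇒≥ lo≮g) (lo-least r k e))
                         (λ g≡k → k≢g (cong black (toℕ-injective (sym g≡k))))
  rightOf-closed g _ {red _} {red _} _ _ _ ()

  pendant-closed : ∀ r → Pendant r → ∀ {x y} → x ≢ black (lo r) → y ≢ black (lo r) →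
    x ≢ red r → Adj x y → y ≢ red r
  pendant-closed r lo≡hi {black k} x≢lo _ _ e refl = x≢lo (cong black (pendant-nbr r k lo≡hi e))
  pendant-closed r lo≡hi {red _} _ _ _ () refl

  infix 4 _∈ᵥ_ _⊆ᵥ_
  _∈ᵥ_ : Vtx m n → VSet E → Set
  _∈ᵥ_ = _∈ᵛ_ E

  _⊆ᵥ_ : VSet E → VSet E → Set
  _⊆ᵥ_ = _⊆ᵛ_ E

  _∈ᵥ?_ : ∀ v S → Dec (v ∈ᵥ S)
  black i ∈ᵥ? S = i ∈ₛ? proj₁ S
  red r ∈ᵥ? S = r ∈ₛ? proj₂ S

  _≟ᵥ_ : (u v : Vtx m n) → Dec (u ≡ v)
  _≟ᵥ_ = ≡-dec _≟ᶠ_ _≟ᶠ_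

  ⊆ᵥ-antisym : ∀ {S S′} → S ⊆ᵥ S′ → S′ ⊆ᵥ S → S ≡ S′
  ⊆ᵥ-antisym S⊆S′ S′⊆S = cong₂ _,_
    (⊆-antisym (λ {x} → S⊆S′ (black x)) (λ {x} → S′⊆S (black x)))
    (⊆-antisym (λ {x} → S⊆S′ (red x)) (λ {x} → S′⊆S (red x)))

  avoiding-walk : ∀ {S} → Biconnected E S → ∀ x {u v} → u ∈ᵥ S → v ∈ᵥ S → u ≢ x → v ≢ x →
    Walk (_≢ x) u v
  avoiding-walk {S} (_ , connected , robust) x u∈S v∈S u≢x v≢x with x ∈ᵥ? S
  ... | yes x∈S = mapʷ (λ _ → proj₂) (robust x x∈S _ _ (u∈S , u≢x) (v∈S , v≢x))
  ... | no x∉S = mapʷ (λ w w∈S w≡x → x∉S (subst (_∈ᵥ S) w≡x w∈S)) (connected _ _ u∈S v∈S)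

  gap-separates : ∀ {S} → Biconnected E S → ∀ g → ¬ Spanned (toℕ g) → ∀ {u v} →
    u ∈ᵥ S → v ∈ᵥ S → u ≢ black g → v ≢ black g → RightOf (toℕ g) u → RightOf (toℕ g) v
  gap-separates bc g unspanned u∈S v∈S u≢g v≢g =
    transport (RightOf (toℕ g)) (rightOf-closed g unspanned) (avoiding-walk bc (black g) u∈S v∈S u≢g v≢g)

  pendant-isolated : ∀ {S} → Biconnected E S → ∀ r → Pendant r → red r ∈ᵥ S →
    ∀ v → v ∈ᵥ S → v ≡ black (lo r) ⊎ v ≡ red r
  pendant-isolated bc r lo≡hi r∈S v v∈S with v ≟ᵥ black (lo r) | v ≟ᵥ red r
  ... | yes v≡lo | _ = inj₁ v≡lo
  ... | _ | yes v≡r = inj₂ v≡r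
  ... | no v≢lo | no v≢r = ⊥-elim (transport (_≢ red r) (pendant-closed r lo≡hi)
          (avoiding-walk bc (black (lo r)) v∈S r∈S v≢lo (λ ())) v≢r refl)

  biconnected-edge : ∀ {S} → Biconnected E S → ∃[ u ] ∃[ w ] (u ∈ᵥ S × w ∈ᵥ S × Adj u w)
  biconnected-edge ((u , v , u∈S , v∈S , u≢v) , connected , _) with first-edge (connected u v u∈S v∈S) u≢v
  ... | (w , u∈S′ , w∈S , e) = u , w , u∈S′ , w∈S , e

  rbTrivial-edge : ∀ {S i r} → Biconnected E S → RbTrivialAt E S i r → T (E i r)
  rbTrivial-edge bc (_ , _ , only) with biconnected-edge bc
  ... | (u , w , u∈S , w∈S , e) with only u u∈S | only w w∈S
  ...   | inj₁ refl | inj₁ refl = ⊥-elim (adj-irrefl u e)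
  ...   | inj₁ refl | inj₂ refl = e
  ...   | inj₂ refl | inj₁ refl = e
  ...   | inj₂ refl | inj₂ refl = ⊥-elim (adj-irrefl u e)

module Intervals {m n : ℕ} (E : Fin m → Fin n → Bool) (red-nbr : ∀ r → ∃[ i ] T (E i r)) where
  open Separation E red-nbr public

  -- Red vertices with a single neighbour are left out: each forms an rb-trivial block of its own.
  InInterval : Fin m → Fin m → Vtx m n → Set
  InInterval a b (black k) = toℕ a ≤ toℕ k × toℕ k ≤ toℕ b
  InInterval a b (red r) = toℕ a ≤ toℕ (lo r) × toℕ (hi r) ≤ toℕ b × Spread r

  inInterval? : ∀ a b v → Dec (InInterval a b v)
  inInterval? a b (black k) = (toℕ a ≤? toℕ k) ×-dec (toℕ k ≤? toℕ b)
  inInterval? a b (red r) =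
    (toℕ a ≤? toℕ (lo r)) ×-dec ((toℕ (hi r) ≤? toℕ b) ×-dec (toℕ (lo r) <? toℕ (hi r)))

  Interval : Fin m → Fin m → VSet E
  Interval a b = select (inInterval? a b ∘ black) , select (inInterval? a b ∘ red)

  ∈-Interval⁺ : ∀ {a b} v → InInterval a b v → v ∈ᵥ Interval a b
  ∈-Interval⁺ {a} {b} (black k) = select⁺ (inInterval? a b ∘ black)
  ∈-Interval⁺ {a} {b} (red r) = select⁺ (inInterval? a b ∘ red)

  ∈-Interval⁻ : ∀ {a b} v → v ∈ᵥ Interval a b → InInterval a b v
  ∈-Interval⁻ {a} {b} (black k) = select⁻ (inInterval? a b ∘ black)
  ∈-Interval⁻ {a} {b} (red r) = select⁻ (inInterval? a b ∘ red)

  red∈Interval : ∀ {a b} r → Spread r → black (lo r) ∈ᵥ Interval a b → black (hi r) ∈ᵥ Interval a b →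
    red r ∈ᵥ Interval a b
  red∈Interval {a} {b} r spread lo∈I hi∈I = ∈-Interval⁺ (red r)
    (proj₁ (∈-Interval⁻ {a} {b} (black (lo r)) lo∈I) ,
     proj₂ (∈-Interval⁻ {a} {b} (black (hi r)) hi∈I) , spread)

  nbr∈Interval : ∀ {a b} k r → T (E k r) → black (lo r) ∈ᵥ Interval a b → black (hi r) ∈ᵥ Interval a b →
    black k ∈ᵥ Interval a b
  nbr∈Interval {a} {b} k r e lo∈I hi∈I = ∈-Interval⁺ (black k)
    (≤-trans (proj₁ (∈-Interval⁻ {a} {b} (black (lo r)) lo∈I)) (lo-least r k e) ,
     ≤-trans (hi-greatest r k e) (proj₂ (∈-Interval⁻ {a} {b} (black (hi r)) hi∈I)))

  LeftEnd RightEnd : Fin m → Set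
  LeftEnd a = toℕ a ≡ 0 ⊎ ¬ Spanned (toℕ a)
  RightEnd b = suc (toℕ b) ≡ m ⊎ ¬ Spanned (toℕ b)

  left-gap : ∀ {a x} → LeftEnd a → x < toℕ a → ¬ Spanned (toℕ a)
  left-gap (inj₁ a≡0) x<a = ⊥-elim (≤⇒≯ z≤n (subst (_ <_) a≡0 x<a))
  left-gap (inj₂ unspanned) _ = unspanned

  right-gap : ∀ {b x} → RightEnd b → toℕ b < x → x < m → ¬ Spanned (toℕ b)
  right-gap (inj₁ 1+b≡m) b<x x<m = ⊥-elim (<⇒≱ b<x (≤-pred (subst (_ <_) (sym 1+b≡m) x<m)))
  right-gap (inj₂ unspanned) _ _ = unspanned

  spans-from-left-end : ∀ {a r p} → LeftEnd a → Spans r p → toℕ a < p → toℕ a ≤ toℕ (lo r)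
  spans-from-left-end {a} {r} left (_ , p<hi) a<p with toℕ (lo r) <? toℕ a
  ... | yes lo<a = ⊥-elim (left-gap left lo<a (r , lo<a , <-trans a<p p<hi))
  ... | no lo≮a = ≮⇒≥ lo≮a

  spans-to-right-end : ∀ {b r p} → RightEnd b → Spans r p → p < toℕ b → toℕ (hi r) ≤ toℕ b
  spans-to-right-end {b} {r} right (lo<p , _) p<b with toℕ b <? toℕ (hi r)
  ... | yes b<hi = ⊥-elim (right-gap right b<hi (toℕ<n (hi r)) (r , <-trans lo<p p<b , b<hi))
  ... | no b≮hi = ≮⇒≥ b≮hi

  inside⇒rightOf-left-end : ∀ {a b} c → InInterval a b c → c ≢ black a → RightOf (toℕ a) c
  inside⇒rightOf-left-end (black k) (a≤k , _) k≢a =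
    ≤∧≢⇒< a≤k (λ a≡k → k≢a (cong black (toℕ-injective (sym a≡k))))
  inside⇒rightOf-left-end (red r) (a≤lo , _ , lo<hi) _ = ≤-<-trans a≤lo lo<hi

  inside⇒¬rightOf-right-end : ∀ {a b} c → InInterval a b c → ¬ RightOf (toℕ b) c
  inside⇒¬rightOf-right-end (black k) (_ , k≤b) = ≤⇒≯ k≤b
  inside⇒¬rightOf-right-end (red r) (_ , hi≤b , _) = ≤⇒≯ hi≤b

  outside : ∀ {a b} → LeftEnd a → RightEnd b → ∀ w → ¬ InInterval a b w →
    (¬ Spanned (toℕ a) × w ≢ black a × ¬ RightOf (toℕ a) w)
    ⊎ (¬ Spanned (toℕ b) × w ≢ black b × RightOf (toℕ b) w)
    ⊎ ∃[ r ] (w ≡ red r × Pendant r)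
  outside {a} {b} left right (black k) out with toℕ a ≤? toℕ k | toℕ k ≤? toℕ b
  ... | yes a≤k | yes k≤b = ⊥-elim (out (a≤k , k≤b))
  ... | no a≰k | _ = inj₁ (left-gap left (≰⇒> a≰k) ,
                          black≢ (λ k≡a → a≰k (≤-reflexive (sym k≡a))) , λ a<k → a≰k (<⇒≤ a<k))
  ... | yes _ | no k≰b = inj₂ (inj₁ (right-gap right (≰⇒> k≰b) (toℕ<n k) ,
                          black≢ (λ k≡b → k≰b (≤-reflexive k≡b)) , ≰⇒> k≰b))
  outside {a} {b} left right (red r) out with pendant-or-spread r
  ... | inj₁ pendant = inj₂ (inj₂ (r , refl , pendant))
  ... | inj₂ spread with toℕ a ≤? toℕ (lo r) | toℕ (hi r) ≤? toℕ b
  ...   | yes a≤lo | yes hi≤b = ⊥-elim (out (a≤lo , hi≤b , spread))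
  ...   | no a≰lo | _ = inj₁ (left-gap left (≰⇒> a≰lo) , (λ ()) ,
                              λ a<hi → left-gap left (≰⇒> a≰lo) (r , ≰⇒> a≰lo , a<hi))
  ...   | yes _ | no hi≰b = inj₂ (inj₁ (right-gap right (≰⇒> hi≰b) (toℕ<n (hi r)) , (λ ()) , ≰⇒> hi≰b))

  avoid-one : ∀ {P : Vtx m n → Set} {u v} → u ≢ v → P u → P v → ∀ x → ∃[ c ] (P c × c ≢ x)
  avoid-one {u = u} u≢v pu pv x with u ≟ᵥ x
  ... | yes refl = _ , pv , λ v≡u → u≢v (sym v≡u)
  ... | no u≢x = u , pu , u≢x

  pendant∉biconnected : ∀ {S a b} → Biconnected E S → ∀ {u v} → u ∈ᵥ S → v ∈ᵥ S → u ≢ v →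
    InInterval a b u → InInterval a b v → ∀ r → Pendant r → ¬ red r ∈ᵥ S
  pendant∉biconnected {S} {a} {b} bc {u} {v} u∈S v∈S u≢v u∈I v∈I r pendant r∈S =
    u≢v (trans (anchored u u∈S u∈I) (sym (anchored v v∈S v∈I)))
    where
      anchored : ∀ x → x ∈ᵥ S → InInterval a b x → x ≡ black (lo r)
      anchored x x∈S x∈I with pendant-isolated bc r pendant r∈S x x∈S
      ... | inj₁ x≡lo = x≡lo
      ... | inj₂ refl = ⊥-elim (spread⇒¬pendant (proj₂ (proj₂ x∈I)) pendant)

  biconnected-⊆-interval : ∀ {S a b} → Biconnected E S → LeftEnd a → RightEnd b →
    ∀ {u v} → u ∈ᵥ S → v ∈ᵥ S → u ≢ v → InInterval a b u → InInterval a b v →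
    S ⊆ᵥ Interval a b
  biconnected-⊆-interval {S} {a} {b} bc left right {u} {v} u∈S v∈S u≢v u∈I v∈I w w∈S
    with inInterval? a b w
  ... | yes w∈I = ∈-Interval⁺ w w∈I
  ... | no w∉I with outside left right w w∉I | avoid-one u≢v (u∈S , u∈I) (v∈S , v∈I) (black a)
                                              | avoid-one u≢v (u∈S , u∈I) (v∈S , v∈I) (black b)
  ...   | inj₁ (unspanned , w≢a , w-left) | (c , (c∈S , c∈I) , c≢a) | _ =
          ⊥-elim (w-left (gap-separates bc a unspanned c∈S w∈S c≢a w≢a (inside⇒rightOf-left-end c c∈I c≢a)))
  ...   | inj₂ (inj₁ (unspanned , w≢b , w-right)) | _ | (c , (c∈S , c∈I) , c≢b) =
          ⊥-elim (inside⇒¬rightOf-right-end c c∈I (gap-separates bc b unspanned w∈S c∈S w≢b c≢b w-right))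
  ...   | inj₂ (inj₂ (r , refl , pendant)) | _ | _ =
          ⊥-elim (pendant∉biconnected bc u∈S v∈S u≢v u∈I v∈I r pendant w∈S)

  module _ (A : Vtx m n → Set) (a b : Fin m) (p : ℕ)
           (blacks : ∀ t → toℕ a ≤ toℕ t → toℕ t ≤ toℕ b → toℕ t ≢ p → A (black t)) where

    -- Black vertices beyond p reach b_a through a red vertex spanning p.
    reach-left-end : toℕ a ≢ p →
      (toℕ a < p → p < toℕ b → ∃[ r ] (A (red r) × toℕ a ≤ toℕ (lo r) × Spans r p × toℕ (hi r) ≤ toℕ b)) →
      ∀ t → toℕ a ≤ toℕ t → toℕ t ≤ toℕ b → toℕ t ≢ p → Walk A (black t) (black a)
    reach-left-end a≢p bridge t a≤t t≤b t≢p with <-cmp (toℕ t) p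
    ... | tri≈ _ t≡p _ = ⊥-elim (t≢p t≡p)
    ... | tri< t<p _ _ = segment A (toℕ a) (toℕ t)
            (λ u a≤u u≤t → blacks u a≤u (≤-trans u≤t t≤b) (<⇒≢ (≤-<-trans u≤t t<p)))
            t a a≤t ≤-refl ≤-refl a≤t
    ... | tri> _ _ p<t with <-cmp (toℕ a) p
    ...   | tri≈ _ a≡p _ = ⊥-elim (a≢p a≡p)
    ...   | tri> _ _ p<a = segment A (toℕ a) (toℕ b)
            (λ u a≤u u≤b → blacks u a≤u u≤b (>⇒≢ (<-≤-trans p<a a≤u)))
            t a a≤t t≤b ≤-refl (≤-trans a≤t t≤b)
    ...   | tri< a<p _ _ with bridge a<p (<-≤-trans p<t t≤b)
    ...     | (r , r∈A , a≤lo , (lo<p , p<hi) , hi≤b) =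
              segment A (suc p) (toℕ b) right-of-p t (hi r) p<t t≤b p<hi hi≤b
              ++ʷ reverseʷ (via-nbr r (hi r) r∈A (hi-adj r) (here hi∈A))
              ++ʷ via-nbr r (lo r) r∈A (lo-adj r)
                    (segment A (toℕ a) (toℕ (lo r)) left-of-p (lo r) a a≤lo ≤-refl ≤-refl a≤lo)
      where
        right-of-p : ∀ u → suc p ≤ toℕ u → toℕ u ≤ toℕ b → A (black u)
        right-of-p u p<u u≤b = blacks u (<⇒≤ (<-trans a<p p<u)) u≤b (>⇒≢ p<u)
        left-of-p : ∀ u → toℕ a ≤ toℕ u → toℕ u ≤ toℕ (lo r) → A (black u)
        left-of-p u a≤u u≤lo =
          blacks u a≤u (≤-trans u≤lo (≤-trans (lo≤hi r) hi≤b)) (<⇒≢ (≤-<-trans u≤lo lo<p))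
        hi∈A : A (black (hi r))
        hi∈A = blacks (hi r) (≤-trans a≤lo (lo≤hi r)) hi≤b (>⇒≢ p<hi)

    reach-right-end : toℕ a ≡ p →
      ∀ t → toℕ a ≤ toℕ t → toℕ t ≤ toℕ b → toℕ t ≢ p → Walk A (black t) (black b)
    reach-right-end refl t a≤t t≤b t≢a =
      segment A (suc (toℕ a)) (toℕ b)
        (λ u a<u u≤b → blacks u (<⇒≤ a<u) u≤b (>⇒≢ a<u))
        t b a<t t≤b (<-≤-trans a<t t≤b) ≤-refl
      where
        a<t : toℕ a < toℕ t
        a<t = ≤∧≢⇒< a≤t (λ a≡t → t≢a (sym a≡t))

  module _ {a b : Fin m} (a<b : toℕ a < toℕ b) (left : LeftEnd a) (right : RightEnd b)
           (interior : ∀ p → toℕ a < p → p < toℕ b → Spanned p) where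

    private
      I : VSet E
      I = Interval a b

      within : ∀ (A : Vtx m n → Set) → (∀ t → toℕ a ≤ toℕ t → toℕ t ≤ toℕ b → A (black t)) →
        ∀ v → A v → InInterval a b v → Walk A v (black a)
      within A blacks (black t) _ (a≤t , t≤b) =
        segment A (toℕ a) (toℕ b) blacks t a a≤t t≤b ≤-refl (<⇒≤ a<b)
      within A blacks (red r) r∈A (a≤lo , hi≤b , _) = via-nbr r (lo r) r∈A (lo-adj r)
        (within A blacks (black (lo r)) (blacks (lo r) a≤lo lo≤b) (a≤lo , lo≤b))
        where
          lo≤b : toℕ (lo r) ≤ toℕ b
          lo≤b = ≤-trans (lo≤hi r) hi≤b

      without : Vtx m n → Vtx m n → Set
      without x v = v ∈ᵥ I × v ≢ x

      without-black : ∀ g t → toℕ a ≤ toℕ t → toℕ t ≤ toℕ b → toℕ t ≢ toℕ g → without (black g) (black t)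
      without-black g t a≤t t≤b t≢g = ∈-Interval⁺ (black t) (a≤t , t≤b) , black≢ t≢g

      robust : ∀ x → x ∈ᵥ I → ConnectedOn E (without x)
      robust (red r₀) _ = connected-through (black a) λ v v∈I∖r₀ →
        within (without (red r₀)) (λ t a≤t t≤b → ∈-Interval⁺ (black t) (a≤t , t≤b) , λ ())
          v v∈I∖r₀ (∈-Interval⁻ v (proj₁ v∈I∖r₀))
      robust (black g) _ with toℕ g ≟ toℕ a
      ... | yes g≡a = connected-through (black b) to-b
        where
          to-b : ∀ v → without (black g) v → Walk (without (black g)) v (black b)
          to-b (black t) (t∈I , t≢g) with ∈-Interval⁻ (black t) t∈I
          ... | (a≤t , t≤b) = reach-right-end (without (black g)) a b (toℕ g) (without-black g) (sym g≡a)
                                t a≤t t≤b (λ t≡g → t≢g (cong black (toℕ-injective t≡g)))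
          to-b (red r) (r∈I , r≢g) with ∈-Interval⁻ (red r) r∈I
          ... | (a≤lo , hi≤b , lo<hi) = via-nbr r (hi r) (r∈I , r≢g) (hi-adj r)
                  (to-b (black (hi r)) (∈-Interval⁺ (black (hi r)) (≤-trans a≤lo (lo≤hi r) , hi≤b) ,
                        black≢ (λ hi≡g → <⇒≢ (≤-<-trans a≤lo lo<hi) (sym (trans hi≡g g≡a)))))
      ... | no g≢a = connected-through (black a) to-a
        where
          bridge : toℕ a < toℕ g → toℕ g < toℕ b →
            ∃[ r ] (without (black g) (red r) × toℕ a ≤ toℕ (lo r) × Spans r (toℕ g) × toℕ (hi r) ≤ toℕ b)
          bridge a<g g<b with interior (toℕ g) a<g g<b
          ... | (r , spans) =
                r , (∈-Interval⁺ (red r) (a≤lo , hi≤b , <-trans (proj₁ spans) (proj₂ spans)) , λ ())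
                  , a≤lo , spans , hi≤b
            where
              a≤lo : toℕ a ≤ toℕ (lo r)
              a≤lo = spans-from-left-end left spans a<g
              hi≤b : toℕ (hi r) ≤ toℕ b
              hi≤b = spans-to-right-end right spans g<b
          to-a : ∀ v → without (black g) v → Walk (without (black g)) v (black a)
          to-a (black t) (t∈I , t≢g) with ∈-Interval⁻ (black t) t∈I
          ... | (a≤t , t≤b) = reach-left-end (without (black g)) a b (toℕ g) (without-black g)
                                (λ a≡g → g≢a (sym a≡g)) bridge
                                t a≤t t≤b (λ t≡g → t≢g (cong black (toℕ-injective t≡g)))
          to-a (red r) (r∈I , r≢g) with ∈-Interval⁻ (red r) r∈I | lo r ≟ᶠ g
          ... | (a≤lo , hi≤b , lo<hi) | no lo≢g = via-nbr r (lo r) (r∈I , r≢g) (lo-adj r)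
                  (to-a (black (lo r)) (∈-Interval⁺ (black (lo r)) (a≤lo , ≤-trans (lo≤hi r) hi≤b) ,
                        λ lo≡g → lo≢g (inj₁-injective lo≡g)))
          ... | (a≤lo , hi≤b , lo<hi) | yes refl = via-nbr r (hi r) (r∈I , r≢g) (hi-adj r)
                  (to-a (black (hi r)) (∈-Interval⁺ (black (hi r)) (≤-trans a≤lo (lo≤hi r) , hi≤b) ,
                        black≢ (>⇒≢ lo<hi)))

    interval-biconnected : Biconnected E (Interval a b)
    interval-biconnected =
      (black a , black b , a∈I , b∈I , black≢ (<⇒≢ a<b)) ,
      connected-through (black a) (λ v v∈I → within (_∈ᵥ I)
        (λ t a≤t t≤b → ∈-Interval⁺ (black t) (a≤t , t≤b)) v v∈I (∈-Interval⁻ v v∈I)) ,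
      robust
      where
        a∈I : black a ∈ᵥ I
        a∈I = ∈-Interval⁺ (black a) (≤-refl , <⇒≤ a<b)
        b∈I : black b ∈ᵥ I
        b∈I = ∈-Interval⁺ (black b) (<⇒≤ a<b , ≤-refl)

  interval-block : ∀ {a b} → toℕ a < toℕ b → LeftEnd a → RightEnd b →
    (∀ p → toℕ a < p → p < toℕ b → Spanned p) → Block E (Interval a b)
  interval-block {a} {b} a<b left right interior =
    interval-biconnected a<b left right interior ,
    λ S′ bc′ I⊆S′ → biconnected-⊆-interval bc′ left right
      (I⊆S′ (black a) (∈-Interval⁺ (black a) (≤-refl , <⇒≤ a<b)))
      (I⊆S′ (black b) (∈-Interval⁺ (black b) (<⇒≤ a<b , ≤-refl)))
      (black≢ (<⇒≢ a<b)) (≤-refl , <⇒≤ a<b) (<⇒≤ a<b , ≤-refl)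

  block≡interval : ∀ {S a b} → Block E S → Biconnected E (Interval a b) → LeftEnd a → RightEnd b →
    ∀ {u v} → u ∈ᵥ S → v ∈ᵥ S → u ≢ v → InInterval a b u → InInterval a b v → S ≡ Interval a b
  block≡interval {S} {a} {b} (bc , maximal) bcI left right u∈S v∈S u≢v u∈I v∈I =
    ⊆ᵥ-antisym S⊆I (maximal _ bcI S⊆I)
    where
      S⊆I : S ⊆ᵥ Interval a b
      S⊆I = biconnected-⊆-interval bc left right u∈S v∈S u≢v u∈I v∈I

  PendantEdge : Fin n → VSet E
  PendantEdge r = ⁅ lo r ⁆ , ⁅ r ⁆

  pendantEdge-rbTrivial : ∀ r → RbTrivialAt E (PendantEdge r) (lo r) r
  pendantEdge-rbTrivial r = x∈⁅x⁆ (lo r) , x∈⁅x⁆ r , members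
    where
      members : ∀ v → v ∈ᵥ PendantEdge r → v ≡ black (lo r) ⊎ v ≡ red r
      members (black k) k∈S = inj₁ (cong black (x∈⁅y⁆⇒x≡y (lo r) k∈S))
      members (red r′) r′∈S = inj₂ (cong red (x∈⁅y⁆⇒x≡y r r′∈S))

  pendantEdge-block : ∀ r → Pendant r → Block E (PendantEdge r)
  pendantEdge-block r pendant = biconnected , maximal
    where
      S : VSet E
      S = PendantEdge r
      members : ∀ v → v ∈ᵥ S → v ≡ black (lo r) ⊎ v ≡ red r
      members = proj₂ (proj₂ (pendantEdge-rbTrivial r))

      to-lo : ∀ v → v ∈ᵥ S → Walk (_∈ᵥ S) v (black (lo r))
      to-lo v v∈S with members v v∈S
      ... | inj₁ refl = here v∈S
      ... | inj₂ refl = edgeʷ v∈S (x∈⁅x⁆ (lo r)) (lo-adj r)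

      robust : ∀ x → x ∈ᵥ S → ConnectedOn E (λ v → v ∈ᵥ S × v ≢ x)
      robust x x∈S u v (u∈S , u≢x) (v∈S , v≢x) with members x x∈S | members u u∈S | members v v∈S
      ... | inj₁ refl | inj₁ refl | _ = ⊥-elim (u≢x refl)
      ... | inj₂ refl | inj₂ refl | _ = ⊥-elim (u≢x refl)
      ... | inj₁ refl | _ | inj₁ refl = ⊥-elim (v≢x refl)
      ... | inj₂ refl | _ | inj₂ refl = ⊥-elim (v≢x refl)
      ... | inj₁ refl | inj₂ refl | inj₂ refl = here (u∈S , u≢x)
      ... | inj₂ refl | inj₁ refl | inj₁ refl = here (u∈S , u≢x)

      biconnected : Biconnected E S
      biconnected = (black (lo r) , red r , x∈⁅x⁆ (lo r) , x∈⁅x⁆ r , λ ()) ,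
                    connected-through (black (lo r)) to-lo , robust

      maximal : ∀ S′ → Biconnected E S′ → S ⊆ᵥ S′ → S′ ⊆ᵥ S
      maximal S′ bc′ S⊆S′ v v∈S′ with pendant-isolated bc′ r pendant (S⊆S′ (red r) (x∈⁅x⁆ r)) v v∈S′
      ... | inj₁ refl = x∈⁅x⁆ (lo r)
      ... | inj₂ refl = x∈⁅x⁆ r

module CutVertices {m n : ℕ} (E : Fin m → Fin n → Bool) (red-nbr : ∀ r → ∃[ i ] T (E i r))
                   (1<m : 1 < m) where
  open Intervals E red-nbr public

  private
    0<m : 0 < m
    0<m = ≤-trans (n≤1+n 1) 1<m

    pred[m]<m : pred m < m
    pred[m]<m = ≤-reflexive (suc-pred m {{>-nonZero 0<m}})

    first last : Fin m
    first = fromℕ< 0<m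
    last = fromℕ< pred[m]<m

    first≤ : ∀ (t : Fin m) → toℕ first ≤ toℕ t
    first≤ t = subst (_≤ toℕ t) (sym (toℕ-fromℕ< 0<m)) z≤n

    ≤last : ∀ (t : Fin m) → toℕ t ≤ toℕ last
    ≤last t = subst (toℕ t ≤_) (sym (toℕ-fromℕ< pred[m]<m)) (<⇒≤pred (toℕ<n t))

    another-black : ∀ (i : Fin m) → ∃[ k ] toℕ k ≢ toℕ i
    another-black i with toℕ i ≟ 0
    ... | yes i≡0 = fromℕ< 1<m , λ eq → 1+n≢0 (trans (sym (toℕ-fromℕ< 1<m)) (trans eq i≡0))
    ... | no i≢0 = first , λ eq → i≢0 (trans (sym eq) (toℕ-fromℕ< 0<m))

  gap-cut : ∀ g → Gap g → CutVertex E (black g)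
  gap-cut g (0<g , 1+g<m , unspanned) =
    black before , black after , black≢ (<⇒≢ before<g) , black≢ (>⇒≢ g<after) , separated
    where
      pred<g : pred (toℕ g) < toℕ g
      pred<g = ≤-reflexive (suc-pred (toℕ g) {{>-nonZero 0<g}})
      before after : Fin m
      before = fromℕ< (<-trans pred<g (toℕ<n g))
      after = fromℕ< 1+g<m
      before<g : toℕ before < toℕ g
      before<g = subst (_< toℕ g) (sym (toℕ-fromℕ< _)) pred<g
      g<after : toℕ g < toℕ after
      g<after = subst (toℕ g <_) (sym (toℕ-fromℕ< 1+g<m)) ≤-refl
      separated : ¬ Walk (_≢ black g) (black before) (black after)
      separated w = <-asym before<g
        (transport (RightOf (toℕ g)) (rightOf-closed g unspanned) (reverseʷ w) g<after)

  pendant-anchor-cut : ∀ r → Pendant r → CutVertex E (black (lo r))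
  pendant-anchor-cut r pendant with another-black (lo r)
  ... | (k , k≢lo) = red r , black k , (λ ()) , black≢ k≢lo ,
        λ w → transport (_≢ red r) (pendant-closed r pendant) (reverseʷ w) (λ ()) refl

  red-not-cut : ∀ r₀ → ¬ CutVertex E (red r₀)
  red-not-cut r₀ (u , v , u≢r₀ , v≢r₀ , disconnected) =
    disconnected (connected-through (black first) to-first u v u≢r₀ v≢r₀)
    where
      to-first : ∀ v → v ≢ red r₀ → Walk (_≢ red r₀) v (black first)
      to-first (black t) _ = reverseʷ (upward (_≢ red r₀) first t (first≤ t) λ _ _ _ ())
      to-first (red r) r≢r₀ = via-nbr r (lo r) r≢r₀ (lo-adj r) (to-first (black (lo r)) λ ())

  black-not-cut : ∀ g → ¬ Gap g → (∀ r → Pendant r → lo r ≢ g) → ¬ CutVertex E (black g)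
  black-not-cut g not-gap no-pendant-at-g (u , v , u≢g , v≢g , disconnected) =
    disconnected (connected-through (proj₁ black-hub) to-hub u v u≢g v≢g)
    where
      A : Vtx m n → Set
      A = _≢ black g

      blacks : ∀ t → toℕ first ≤ toℕ t → toℕ t ≤ toℕ last → toℕ t ≢ toℕ g → A (black t)
      blacks t _ _ = black≢

      bridge : toℕ first < toℕ g → toℕ g < toℕ last →
        ∃[ r ] (A (red r) × toℕ first ≤ toℕ (lo r) × Spans r (toℕ g) × toℕ (hi r) ≤ toℕ last)
      bridge first<g g<last with ¬gap g not-gap
      ... | inj₁ g≡0 = ⊥-elim (<-irrefl (trans (toℕ-fromℕ< 0<m) (sym g≡0)) first<g)
      ... | inj₂ (inj₁ 1+g≡m) =
            ⊥-elim (<-irrefl (trans (cong pred 1+g≡m) (sym (toℕ-fromℕ< pred[m]<m))) g<last)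
      ... | inj₂ (inj₂ (r , spans)) = r , (λ ()) , first≤ (lo r) , spans , ≤last (hi r)

      black-hub : ∃[ h ] (∀ t → toℕ t ≢ toℕ g → Walk A (black t) h)
      black-hub with toℕ g ≟ toℕ first
      ... | yes g≡first = black last , λ t t≢g →
            reach-right-end A first last (toℕ g) blacks (sym g≡first) t (first≤ t) (≤last t) t≢g
      ... | no g≢first = black first , λ t t≢g →
            reach-left-end A first last (toℕ g) blacks (λ eq → g≢first (sym eq)) bridge
              t (first≤ t) (≤last t) t≢g

      other-nbr : ∀ r → ∃[ k ] (T (E k r) × toℕ k ≢ toℕ g)
      other-nbr r with lo r ≟ᶠ g
      ... | no lo≢g = lo r , lo-adj r , λ eq → lo≢g (toℕ-injective eq)
      ... | yes lo≡g = hi r , hi-adj r ,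
            λ eq → no-pendant-at-g r (trans lo≡g (sym (toℕ-injective eq))) lo≡g

      to-hub : ∀ v → A v → Walk A v (proj₁ black-hub)
      to-hub (black t) t≢g = proj₂ black-hub t (λ eq → t≢g (cong black (toℕ-injective eq)))
      to-hub (red r) r≢g with other-nbr r
      ... | (k , e , k≢g) = via-nbr r k r≢g e (proj₂ black-hub k k≢g)

  non-gap-cut-anchors : ∀ i → ¬ Gap i → CutVertex E (black i) → ∃[ r ] (Pendant r × lo r ≡ i)
  non-gap-cut-anchors i not-gap i-cut with any? (λ r → (lo r ≟ᶠ hi r) ×-dec (lo r ≟ᶠ i))
  ... | yes anchored = anchored
  ... | no none = ⊥-elim (black-not-cut i not-gap (λ r pendant lo≡i → none (r , pendant , lo≡i)) i-cut)

module Segments {q : ℕ} (β : Fin (suc (suc q)) → ℕ) (β-mono : ∀ i j → toℕ i < toℕ j → β i < β j) where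

  InSegment : Fin (suc q) → ℕ → Set
  InSegment j x = β (inject₁ j) ≤ x × x ≤ β (fsuc j)

  β-mono-≤ : ∀ i j → toℕ i ≤ toℕ j → β i ≤ β j
  β-mono-≤ i j i≤j with m≤n⇒m<n∨m≡n i≤j
  ... | inj₁ i<j = <⇒≤ (β-mono i j i<j)
  ... | inj₂ i≡j = ≤-reflexive (cong β (toℕ-injective i≡j))

  β-cancel-≤ : ∀ i j → β i ≤ β j → toℕ i ≤ toℕ j
  β-cancel-≤ i j βi≤βj = ≮⇒≥ (λ j<i → <⇒≱ (β-mono j i j<i) βi≤βj)

  β-cancel-< : ∀ i j → β i < β j → toℕ i < toℕ j
  β-cancel-< i j βi<βj = ≰⇒> (λ j≤i → <⇒≱ βi<βj (β-mono-≤ j i j≤i))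

  β-injective : ∀ i j → β i ≡ β j → i ≡ j
  β-injective i j βi≡βj = toℕ-injective (≤-antisym
    (β-cancel-≤ i j (≤-reflexive βi≡βj)) (β-cancel-≤ j i (≤-reflexive (sym βi≡βj))))

  segment-nonempty : ∀ j → β (inject₁ j) < β (fsuc j)
  segment-nonempty j = β-mono (inject₁ j) (fsuc j) (≤-reflexive (cong suc (toℕ-inject₁ j)))

  segments-ordered : ∀ j j′ → toℕ j < toℕ j′ → β (fsuc j) ≤ β (inject₁ j′)
  segments-ordered j j′ j<j′ =
    β-mono-≤ (fsuc j) (inject₁ j′) (subst (suc (toℕ j) ≤_) (sym (toℕ-inject₁ j′)) j<j′)

  boundary∈segments : ∀ k → InSegment (inject₁ k) (β (fsuc (inject₁ k)))
                          × InSegment (fsuc k) (β (fsuc (inject₁ k)))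
  boundary∈segments k = (<⇒≤ (segment-nonempty (inject₁ k)) , ≤-refl) ,
                        (≤-refl , <⇒≤ (segment-nonempty (fsuc k)))

  segments-at-boundary : ∀ k j → InSegment j (β (fsuc (inject₁ k))) → j ≡ inject₁ k ⊎ j ≡ fsuc k
  segments-at-boundary k j (start≤ , ≤end) with m≤n⇒m<n∨m≡n k≤j
    where
      k≤j : toℕ k ≤ toℕ j
      k≤j = subst (_≤ toℕ j) (toℕ-inject₁ k) (s≤s⁻¹ (β-cancel-≤ (fsuc (inject₁ k)) (fsuc j) ≤end))
  ... | inj₂ k≡j = inj₁ (toℕ-injective (trans (sym k≡j) (sym (toℕ-inject₁ k))))
  ... | inj₁ k<j = inj₂ (toℕ-injective (≤-antisym j≤1+k k<j))
    where
      j≤1+k : toℕ j ≤ suc (toℕ k)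
      j≤1+k = subst₂ _≤_ (toℕ-inject₁ j) (cong suc (toℕ-inject₁ k))
                (β-cancel-≤ (inject₁ j) (fsuc (inject₁ k)) start≤)

  shared-point : ∀ {x} j j′ → InSegment j x → InSegment j′ x → toℕ j < toℕ j′ →
    ∃[ k ] (j ≡ inject₁ k × j′ ≡ fsuc k × x ≡ β (fsuc (inject₁ k)))
  shared-point j (fsuc k) (_ , x≤end) (start′≤x , _) j<j′ =
    k , fsuc-injective (β-injective (fsuc j) (fsuc (inject₁ k)) ends-meet) , refl ,
    ≤-antisym (≤-trans x≤end (≤-reflexive ends-meet)) start′≤x
    where
      ends-meet : β (fsuc j) ≡ β (fsuc (inject₁ k))
      ends-meet = ≤-antisym (segments-ordered j (fsuc k) j<j′) (≤-trans start′≤x x≤end)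

  no-boundary-inside : ∀ j i → β (inject₁ j) < β i → β i < β (fsuc j) → ⊥
  no-boundary-inside j i start<βi βi<end = <⇒≱ (β-cancel-< i (fsuc j) βi<end)
    (subst (_< toℕ i) (toℕ-inject₁ j) (β-cancel-< (inject₁ j) i start<βi))

  locate : ∀ a c → β fzero ≤ a → c ≤ β (fromℕ (suc q)) → (∀ i → a < β i → β i < c → ⊥) →
    ∃[ j ] (β (inject₁ j) ≤ a × c ≤ β (fsuc j))
  locate a c β₀≤a c≤βₗ no-boundary with least (λ t → c ≤? β t) (fromℕ (suc q) , c≤βₗ)
  ... | (fzero , c≤β₀ , _) = fzero , β₀≤a , ≤-trans c≤β₀ (<⇒≤ (segment-nonempty fzero))
  ... | (fsuc j , c≤βt , t-least) = j , ≮⇒≥ (λ a<βj → no-boundary (inject₁ j) a<βj βj<c) , c≤βt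
    where
      βj<c : β (inject₁ j) < c
      βj<c = ≰⇒> (λ c≤βj → <⇒≱ (≤-reflexive (cong suc (toℕ-inject₁ j))) (t-least (inject₁ j) c≤βj))

module _ {m n : ℕ} (E : Fin m → Fin n → Bool) where

  hiP-inject₁ : ∀ {q} (δ : Fin q → Fin m) k → hiP E δ (inject₁ k) ≡ toℕ (δ k)
  hiP-inject₁ δ fzero = refl
  hiP-inject₁ δ (fsuc k) = hiP-inject₁ (δ ∘ fsuc) k

  hiP-fromℕ : ∀ {q} (δ : Fin q → Fin m) → hiP E δ (fromℕ q) ≡ m ∸ 1
  hiP-fromℕ {zero} δ = refl
  hiP-fromℕ {suc q} δ = hiP-fromℕ (δ ∘ fsuc)

module BlockCutTree {m n : ℕ} (E : Fin m → Fin n → Bool) (red-nbr : ∀ r → ∃[ i ] T (E i r))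
                    (1<m : 1 < m) where
  open CutVertices E red-nbr 1<m public

  -- Only the three properties below of the enumeration of the gaps are used.
  abstract
    gaps : List (Fin m)
    gaps = filter gap? (allFin m)

    q′ : ℕ
    q′ = length gaps

    γ : Fin q′ → Fin m
    γ = lookup gaps

    γ-gap : ∀ k → Gap (γ k)
    γ-gap k = proj₂ (∈-filter⁻ gap? {xs = allFin m} (∈-lookup k))

    γ-mono : ∀ k k′ → toℕ k < toℕ k′ → toℕ (γ k) < toℕ (γ k′)
    γ-mono = allPairs-lookup (filter⁺ gap? (tabulate⁺-< {R = λ i j → toℕ i < toℕ j} (λ i<j → i<j)))

    γ-complete : ∀ g → Gap g → ∃[ k ] γ k ≡ g
    γ-complete g g-gap = index g∈gaps , sym (lookup-index g∈gaps)
      where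
        g∈gaps : g ∈ˡ gaps
        g∈gaps = ∈-filter⁺ gap? (∈-allFin g) g-gap

  -- The segment ends 0, γ₀, …, m ∸ 1: H⁻ j contains the blacks from boundary (inject₁ j)
  -- to boundary (fsuc j), which are loP γ j and hiP γ j.
  boundary : Fin (suc (suc q′)) → ℕ
  boundary fzero = 0
  boundary (fsuc j) = hiP E γ j

  γ≡boundary : ∀ k → toℕ (γ k) ≡ boundary (fsuc (inject₁ k))
  γ≡boundary k = sym (hiP-inject₁ E γ k)

  boundary-last : boundary (fromℕ (suc q′)) ≡ m ∸ 1
  boundary-last = hiP-fromℕ E γ

  γ<m∸1 : ∀ k → toℕ (γ k) < m ∸ 1
  γ<m∸1 k = ∸-monoˡ-≤ 1 (proj₁ (proj₂ (γ-gap k)))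

  hiP-positive : ∀ j → 0 < hiP E γ j
  hiP-positive j with view j
  ... | ‵fromℕ = subst (0 <_) (sym (hiP-fromℕ E γ)) (∸-monoˡ-≤ 1 1<m)
  ... | ‵inject₁ k = subst (0 <_) (γ≡boundary k) (proj₁ (γ-gap k))

  hiP-mono : ∀ i j → toℕ i < toℕ j → hiP E γ i < hiP E γ j
  hiP-mono i j i<j with view i | view j
  ... | ‵fromℕ | _ = ⊥-elim (<⇒≱ i<j (subst (toℕ j ≤_) (sym (toℕ-fromℕ q′)) (s≤s⁻¹ (toℕ<n j))))
  ... | ‵inject₁ k | ‵fromℕ = subst₂ _<_ (γ≡boundary k) (sym (hiP-fromℕ E γ)) (γ<m∸1 k)
  ... | ‵inject₁ k | ‵inject₁ k′ = subst₂ _<_ (γ≡boundary k) (γ≡boundary k′)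
        (γ-mono k k′ (subst₂ _<_ (toℕ-inject₁ k) (toℕ-inject₁ k′) i<j))

  boundary-mono : ∀ i j → toℕ i < toℕ j → boundary i < boundary j
  boundary-mono fzero (fsuc j) _ = hiP-positive j
  boundary-mono (fsuc i) (fsuc j) i<j = hiP-mono i j (s≤s⁻¹ i<j)

  open Segments boundary boundary-mono public

  boundary<m : ∀ i → boundary i < m
  boundary<m i = <-≤-trans (s≤s (subst (boundary i ≤_) boundary-last (β-mono-≤ i (fromℕ (suc q′)) i≤last)))
                      (≤-reflexive (suc-pred m {{>-nonZero (≤-trans (n≤1+n 1) 1<m)}}))
    where
      i≤last : toℕ i ≤ toℕ (fromℕ (suc q′))
      i≤last = subst (toℕ i ≤_) (sym (toℕ-fromℕ (suc q′))) (s≤s⁻¹ (toℕ<n i))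

  start end : Fin (suc q′) → Fin m
  start j = fromℕ< (boundary<m (inject₁ j))
  end j = fromℕ< (boundary<m (fsuc j))

  toℕ-start : ∀ j → toℕ (start j) ≡ boundary (inject₁ j)
  toℕ-start j = toℕ-fromℕ< (boundary<m (inject₁ j))

  toℕ-end : ∀ j → toℕ (end j) ≡ boundary (fsuc j)
  toℕ-end j = toℕ-fromℕ< (boundary<m (fsuc j))

  loP≡boundary : ∀ j → loP E γ j ≡ boundary (inject₁ j)
  loP≡boundary fzero = refl
  loP≡boundary (fsuc k) = γ≡boundary k

  H⁻ : Fin (suc q′) → VSet E
  H⁻ j = Interval (start j) (end j)

  ∈H⁻⁺ : ∀ j v → InInterval (start j) (end j) v → v ∈ᵥ H⁻ j
  ∈H⁻⁺ j = ∈-Interval⁺ {start j} {end j}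

  ∈H⁻⁻ : ∀ j v → v ∈ᵥ H⁻ j → InInterval (start j) (end j) v
  ∈H⁻⁻ j = ∈-Interval⁻ {start j} {end j}

  black∈H⁻⁺ : ∀ j {x} → InSegment j (toℕ x) → black x ∈ᵥ H⁻ j
  black∈H⁻⁺ j {x} (start≤x , x≤end) = ∈H⁻⁺ j (black x)
    (subst (_≤ toℕ x) (sym (toℕ-start j)) start≤x , subst (toℕ x ≤_) (sym (toℕ-end j)) x≤end)

  black∈H⁻⁻ : ∀ j {x} → black x ∈ᵥ H⁻ j → InSegment j (toℕ x)
  black∈H⁻⁻ j {x} x∈H⁻ with ∈H⁻⁻ j (black x) x∈H⁻
  ... | (start≤x , x≤end) = subst (_≤ toℕ x) (toℕ-start j) start≤x , subst (toℕ x ≤_) (toℕ-end j) x≤end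

  start<end : ∀ j → toℕ (start j) < toℕ (end j)
  start<end j = subst₂ _<_ (sym (toℕ-start j)) (sym (toℕ-end j)) (segment-nonempty j)

  start-left-end : ∀ j → LeftEnd (start j)
  start-left-end fzero = inj₁ (toℕ-start fzero)
  start-left-end (fsuc k) =
    inj₂ (subst (¬_ ∘ Spanned) (trans (γ≡boundary k) (sym (toℕ-start (fsuc k)))) (proj₂ (proj₂ (γ-gap k))))

  end-right-end : ∀ j → RightEnd (end j)
  end-right-end j with view j
  ... | ‵fromℕ = inj₁ (trans (cong suc (trans (toℕ-end (fromℕ q′)) (hiP-fromℕ E γ)))
                             (suc-pred m {{>-nonZero (≤-trans (n≤1+n 1) 1<m)}}))
  ... | ‵inject₁ k = inj₂ (subst (¬_ ∘ Spanned) (trans (γ≡boundary k) (sym (toℕ-end (inject₁ k))))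
                                 (proj₂ (proj₂ (γ-gap k))))

  interior-spanned : ∀ j p → toℕ (start j) < p → p < toℕ (end j) → Spanned p
  interior-spanned j p start<p p<end with spanned? p
  ... | yes spanned = spanned
  ... | no unspanned with γ-complete g (0<g , 1+g<m , subst (¬_ ∘ Spanned) (sym toℕ-g) unspanned)
    where
      p<m : p < m
      p<m = <-trans p<end (toℕ<n (end j))
      g : Fin m
      g = fromℕ< p<m
      toℕ-g : toℕ g ≡ p
      toℕ-g = toℕ-fromℕ< p<m
      0<g : 0 < toℕ g
      0<g = subst (0 <_) (sym toℕ-g) (≤-<-trans z≤n start<p)
      1+g<m : suc (toℕ g) < m
      1+g<m = subst (λ x → suc x < m) (sym toℕ-g) (≤-<-trans p<end (toℕ<n (end j)))
  ... | (k , γk≡g) = ⊥-elim (no-boundary-inside j (fsuc (inject₁ k))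
          (subst₂ _<_ (toℕ-start j) γk≡p start<p) (subst₂ _<_ γk≡p (toℕ-end j) p<end))
    where
      γk≡p : p ≡ boundary (fsuc (inject₁ k))
      γk≡p = trans (sym (toℕ-fromℕ< _)) (trans (cong toℕ (sym γk≡g)) (γ≡boundary k))

  H⁻-block : ∀ j → Block E (H⁻ j)
  H⁻-block j = interval-block (start<end j) (start-left-end j) (end-right-end j) (interior-spanned j)

  block≡H⁻ : ∀ {S} → Block E S → ∀ j {u v} → u ∈ᵥ S → v ∈ᵥ S → u ≢ v → u ∈ᵥ H⁻ j → v ∈ᵥ H⁻ j →
    S ≡ H⁻ j
  block≡H⁻ blk j {u} {v} u∈S v∈S u≢v u∈H⁻ v∈H⁻ =
    block≡interval blk (proj₁ (H⁻-block j)) (start-left-end j) (end-right-end j)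
      u∈S v∈S u≢v (∈H⁻⁻ j u u∈H⁻) (∈H⁻⁻ j v v∈H⁻)

  start∈H⁻ : ∀ j → black (start j) ∈ᵥ H⁻ j
  start∈H⁻ j = ∈H⁻⁺ j (black (start j)) (≤-refl , <⇒≤ (start<end j))

  end∈H⁻ : ∀ j → black (end j) ∈ᵥ H⁻ j
  end∈H⁻ j = ∈H⁻⁺ j (black (end j)) (<⇒≤ (start<end j) , ≤-refl)

  H⁻-nontrivial : ∀ j → ¬ RbTrivial E (H⁻ j)
  H⁻-nontrivial j (i , r , _ , _ , only) with only _ (start∈H⁻ j) | only _ (end∈H⁻ j)
  ... | inj₁ start≡i | inj₁ end≡i = black≢ (<⇒≢ (start<end j)) (trans start≡i (sym end≡i))
  ... | inj₂ () | _
  ... | inj₁ _ | inj₂ ()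

  start∉later : ∀ j j′ → black (start j) ∈ᵥ H⁻ j′ → ¬ toℕ j < toℕ j′
  start∉later j j′ start∈H⁻j′ j<j′ = <⇒≱ (segment-nonempty j)
    (≤-trans (segments-ordered j j′ j<j′)
             (subst (_ ≤_) (toℕ-start j) (proj₁ (black∈H⁻⁻ j′ start∈H⁻j′))))

  H⁻-injective : ∀ j j′ → H⁻ j ≡ H⁻ j′ → j ≡ j′
  H⁻-injective j j′ H⁻j≡H⁻j′ with <-cmp (toℕ j) (toℕ j′)
  ... | tri≈ _ j≡j′ _ = toℕ-injective j≡j′
  ... | tri< j<j′ _ _ =
        ⊥-elim (start∉later j j′ (subst (black (start j) ∈ᵥ_) H⁻j≡H⁻j′ (start∈H⁻ j)) j<j′)
  ... | tri> _ _ j′<j =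
        ⊥-elim (start∉later j′ j (subst (black (start j′) ∈ᵥ_) (sym H⁻j≡H⁻j′) (start∈H⁻ j′)) j′<j)

  boundary-unspanned : ∀ i → 0 < boundary i → boundary i < m ∸ 1 → ¬ Spanned (boundary i)
  boundary-unspanned (fsuc j) _ βi<m∸1 with view j
  ... | ‵fromℕ = ⊥-elim (<-irrefl (hiP-fromℕ E γ) βi<m∸1)
  ... | ‵inject₁ k = subst (¬_ ∘ Spanned) (γ≡boundary k) (proj₂ (proj₂ (γ-gap k)))

  locate-spanned : ∀ (a c : Fin m) → toℕ a ≤ toℕ c → (∀ p → toℕ a < p → p < toℕ c → Spanned p) →
    ∃[ j ] (black a ∈ᵥ H⁻ j × black c ∈ᵥ H⁻ j)
  locate-spanned a c a≤c spanned
    with locate (toℕ a) (toℕ c) z≤n (subst (toℕ c ≤_) (sym boundary-last) (<⇒≤pred (toℕ<n c))) no-boundary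
    where
      no-boundary : ∀ i → toℕ a < boundary i → boundary i < toℕ c → ⊥
      no-boundary i a<βi βi<c = boundary-unspanned i (≤-<-trans z≤n a<βi)
        (<-≤-trans βi<c (<⇒≤pred (toℕ<n c))) (spanned (boundary i) a<βi βi<c)
  ... | (j , start≤a , c≤end) =
        j , black∈H⁻⁺ j (start≤a , ≤-trans a≤c c≤end) , black∈H⁻⁺ j (≤-trans start≤a a≤c , c≤end)

  path-edge-in-H⁻ : ∀ x y → toℕ y ≡ suc (toℕ x) → ∃[ j ] (black x ∈ᵥ H⁻ j × black y ∈ᵥ H⁻ j)
  path-edge-in-H⁻ x y y≡1+x = locate-spanned x y (≤-trans (n≤1+n _) (≤-reflexive (sym y≡1+x)))
    (λ p x<p p<y → ⊥-elim (<⇒≱ x<p (s≤s⁻¹ (subst (p <_) y≡1+x p<y))))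

  spread-edge-in-H⁻ : ∀ k r → T (E k r) → Spread r → ∃[ j ] (black k ∈ᵥ H⁻ j × red r ∈ᵥ H⁻ j)
  spread-edge-in-H⁻ k r e spread =
    map₂ (λ {j} (lo∈H⁻ , hi∈H⁻) → nbr∈Interval {start j} {end j} k r e lo∈H⁻ hi∈H⁻ ,
                                   red∈Interval {start j} {end j} r spread lo∈H⁻ hi∈H⁻)
         (locate-spanned (lo r) (hi r) (lo≤hi r) (λ p lo<p p<hi → r , lo<p , p<hi))

  red-edge-in-H⁻ : ∀ {S} → Biconnected E S → ¬ RbTrivial E S →
    ∀ k r → black k ∈ᵥ S → red r ∈ᵥ S → T (E k r) → ∃[ j ] (black k ∈ᵥ H⁻ j × red r ∈ᵥ H⁻ j)
  red-edge-in-H⁻ {S} bc nontrivial k r k∈S r∈S e with pendant-or-spread r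
  ... | inj₂ spread = spread-edge-in-H⁻ k r e spread
  ... | inj₁ pendant = ⊥-elim (nontrivial (lo r , r ,
          subst (λ i → black i ∈ᵥ S) (pendant-nbr r k pendant e) k∈S , r∈S ,
          pendant-isolated bc r pendant r∈S))

  edge-in-H⁻ : ∀ {S} → Biconnected E S → ¬ RbTrivial E S →
    ∀ u w → u ∈ᵥ S → w ∈ᵥ S → Adj u w → ∃[ j ] (u ∈ᵥ H⁻ j × w ∈ᵥ H⁻ j)
  edge-in-H⁻ bc nontrivial (black x) (black y) _ _ e with path-adj⁻ x y e
  ... | inj₁ y≡1+x = path-edge-in-H⁻ x y y≡1+x
  ... | inj₂ x≡1+y = map₂ swap (path-edge-in-H⁻ y x x≡1+y)
  edge-in-H⁻ bc nontrivial (black k) (red r) k∈S r∈S e = red-edge-in-H⁻ bc nontrivial k r k∈S r∈S e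
  edge-in-H⁻ bc nontrivial (red r) (black k) r∈S k∈S e =
    map₂ swap (red-edge-in-H⁻ bc nontrivial k r k∈S r∈S e)
  edge-in-H⁻ _ _ (red _) (red _) _ _ ()

  H⁻-onto : ∀ S → Block E S → ¬ RbTrivial E S → ∃[ j ] H⁻ j ≡ S
  H⁻-onto S blk nontrivial with biconnected-edge (proj₁ blk)
  ... | (u , w , u∈S , w∈S , e) with edge-in-H⁻ (proj₁ blk) nontrivial u w u∈S w∈S e
  ...   | (j , u∈H⁻ , w∈H⁻) = j , sym (block≡H⁻ blk j u∈S w∈S u≢w u∈H⁻ w∈H⁻)
    where
      u≢w : u ≢ w
      u≢w u≡w = adj-irrefl w (subst (λ x → Adj x w) u≡w e)

  rbTrivial-block-pendant : ∀ {S i r} → Block E S → RbTrivialAt E S i r → Pendant r × i ≡ lo r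
  rbTrivial-block-pendant {S} {i} {r} blk rbTrivial@(i∈S , r∈S , _) with pendant-or-spread r
  ... | inj₁ pendant = pendant , pendant-nbr r i pendant (rbTrivial-edge (proj₁ blk) rbTrivial)
  ... | inj₂ spread =
    let (j , i∈H⁻ , r∈H⁻) = spread-edge-in-H⁻ i r (rbTrivial-edge (proj₁ blk) rbTrivial) spread
    in ⊥-elim (H⁻-nontrivial j (i , r ,
         subst (λ S′ → RbTrivialAt E S′ i r)
               (block≡H⁻ blk j {black i} {red r} i∈S r∈S (λ ()) i∈H⁻ r∈H⁻) rbTrivial))

  γ∈H⁻ : ∀ k → black (γ k) ∈ᵥ H⁻ (inject₁ k) × black (γ k) ∈ᵥ H⁻ (fsuc k)
  γ∈H⁻ k =
    black∈H⁻⁺ (inject₁ k) (subst (InSegment (inject₁ k)) (sym (γ≡boundary k)) (proj₁ (boundary∈segments k))) ,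
    black∈H⁻⁺ (fsuc k) (subst (InSegment (fsuc k)) (sym (γ≡boundary k)) (proj₂ (boundary∈segments k)))

  H⁻-containing-γ : ∀ k j → black (γ k) ∈ᵥ H⁻ j → j ≡ inject₁ k ⊎ j ≡ fsuc k
  H⁻-containing-γ k j γ∈H⁻j =
    segments-at-boundary k j (subst (InSegment j) (γ≡boundary k) (black∈H⁻⁻ j γ∈H⁻j))

  boundary-gap : ∀ i k → toℕ i ≡ boundary (fsuc (inject₁ k)) → Gap i
  boundary-gap i k i≡boundary = subst Gap (toℕ-injective (trans (γ≡boundary k) (sym i≡boundary))) (γ-gap k)

  H⁻-containing-non-gap : ∀ i → ¬ Gap i → ∀ j j′ → black i ∈ᵥ H⁻ j → black i ∈ᵥ H⁻ j′ → j′ ≡ j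
  H⁻-containing-non-gap i not-gap j j′ i∈H⁻j i∈H⁻j′ with <-cmp (toℕ j′) (toℕ j)
  ... | tri≈ _ j′≡j _ = toℕ-injective j′≡j
  ... | tri< j′<j _ _ =
        let (k , _ , _ , i≡boundary) = shared-point j′ j (black∈H⁻⁻ j′ i∈H⁻j′) (black∈H⁻⁻ j i∈H⁻j) j′<j
        in ⊥-elim (not-gap (boundary-gap i k i≡boundary))
  ... | tri> _ _ j<j′ =
        let (k , _ , _ , i≡boundary) = shared-point j j′ (black∈H⁻⁻ j i∈H⁻j) (black∈H⁻⁻ j′ i∈H⁻j′) j<j′
        in ⊥-elim (not-gap (boundary-gap i k i≡boundary))

  gap-position : ∀ i k → γ k ≡ i →
    i ≡ γ k × black i ∈ᵥ H⁻ (inject₁ k) × black i ∈ᵥ H⁻ (fsuc k)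
    × (∀ j′ → black i ∈ᵥ H⁻ j′ → j′ ≡ inject₁ k ⊎ j′ ≡ fsuc k)
  gap-position _ k refl = refl , proj₁ (γ∈H⁻ k) , proj₂ (γ∈H⁻ k) , H⁻-containing-γ k

  black-position : ∀ i →
    (¬ Gap i × ∃[ j ] (black i ∈ᵥ H⁻ j × (∀ j′ → black i ∈ᵥ H⁻ j′ → j′ ≡ j)))
    ⊎ (∃[ k ] ( i ≡ γ k × black i ∈ᵥ H⁻ (inject₁ k) × black i ∈ᵥ H⁻ (fsuc k)
              × (∀ j′ → black i ∈ᵥ H⁻ j′ → j′ ≡ inject₁ k ⊎ j′ ≡ fsuc k)))
  black-position i with gap? i
  ... | yes i-gap = let (k , γk≡i) = γ-complete i i-gap in inj₂ (k , gap-position i k γk≡i)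
  ... | no not-gap =
    let (j , i∈H⁻ , _) = locate-spanned i i ≤-refl (λ p i<p p<i → ⊥-elim (<-asym i<p p<i))
    in inj₁ (not-gap , j , i∈H⁻ , λ j′ i∈H⁻j′ → H⁻-containing-non-gap i not-gap j j′ i∈H⁻ i∈H⁻j′)

  rbTrivial-anchor-cut : ∀ {S i r} → Block E S → RbTrivialAt E S i r → CutVertex E (black i)
  rbTrivial-anchor-cut blk rbTrivial =
    let (pendant , i≡lo) = rbTrivial-block-pendant blk rbTrivial
    in subst (CutVertex E ∘ black) (sym i≡lo) (pendant-anchor-cut _ pendant)

  leaf : ∀ S i r → Block E S → RbTrivialAt E S i r →
    BCAdj E S (black i) × (∀ v → BCAdj E S v → v ≡ black i) ×
    ( (∃[ j ] (black i ∈ᵥ H⁻ j × (∀ j′ → black i ∈ᵥ H⁻ j′ → j′ ≡ j) × BCAdj E (H⁻ j) (black i)))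
    ⊎ (∃[ k ] ( i ≡ γ k × black i ∈ᵥ H⁻ (inject₁ k) × black i ∈ᵥ H⁻ (fsuc k)
              × (∀ j′ → black i ∈ᵥ H⁻ j′ → j′ ≡ inject₁ k ⊎ j′ ≡ fsuc k))))
  leaf S i r blk rbTrivial@(i∈S , _ , only) =
    (blk , i-cut , i∈S) , only-neighbour ,
    map₁ (λ (_ , j , i∈H⁻ , unique) → j , i∈H⁻ , unique , H⁻-block j , i-cut , i∈H⁻) (black-position i)
    where
      i-cut : CutVertex E (black i)
      i-cut = rbTrivial-anchor-cut blk rbTrivial
      only-neighbour : ∀ v → BCAdj E S v → v ≡ black i
      only-neighbour v (_ , v-cut , v∈S) with only v v∈S
      ... | inj₁ v≡i = v≡i
      ... | inj₂ refl = ⊥-elim (red-not-cut r v-cut)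

  tree-edge : ∀ j v → BCAdj E (H⁻ j) v →
    (∃[ k ] (v ≡ black (γ k) × (j ≡ inject₁ k ⊎ j ≡ fsuc k)))
    ⊎ (∃[ i ] ( v ≡ black i × (∀ j′ → black i ∈ᵥ H⁻ j′ → j′ ≡ j)
              × ∃[ S ] ∃[ r ] (Block E S × RbTrivialAt E S i r)))
  tree-edge j (red r) (_ , r-cut , _) = ⊥-elim (red-not-cut r r-cut)
  tree-edge j (black i) (_ , i-cut , i∈H⁻j) =
    [ (λ (not-gap , _ , _ , unique) →
         let (r , pendant , lo≡i) = non-gap-cut-anchors i not-gap i-cut
         in inj₂ (i , refl , (λ j′ i∈H⁻j′ → trans (unique j′ i∈H⁻j′) (sym (unique j i∈H⁻j))) ,
                  PendantEdge r , r , pendantEdge-block r pendant ,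
                  subst (λ x → RbTrivialAt E (PendantEdge r) x r) lo≡i (pendantEdge-rbTrivial r)))
    , (λ (k , i≡γk , _ , _ , H⁻s∋i) → inj₁ (k , cong black i≡γk , H⁻s∋i j i∈H⁻j))
    ]′ (black-position i)

lemma11 : ∀ {m n : ℕ} (E : Fin m → Fin n → Bool) →
    3 ≤ m → 3 ≤ n →
    HPlanar E →
    (∀ (i : Fin m) → ∃[ r ] T (E i r)) →
    (∀ (r : Fin n) → ∃[ i ] T (E i r)) →
    BlockCutStructure E
lemma11 E 3≤m _ _ _ red-nbr = record
  { q' = q′
  ; H⁻ = H⁻
  ; γ = γ
  ; H⁻-block = H⁻-block
  ; H⁻-nontriv = H⁻-nontrivial
  ; H⁻-injective = H⁻-injective
  ; H⁻-onto = H⁻-onto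
  ; γ-lower = λ k → proj₁ (γ-gap k)
  ; γ-upper = λ k → proj₁ (proj₂ (γ-gap k))
  ; γ-mono = γ-mono
  ; Q-path = λ k → (H⁻-block (inject₁ k) , gap-cut (γ k) (γ-gap k) , proj₁ (γ∈H⁻ k))
                 , (H⁻-block (fsuc k) , gap-cut (γ k) (γ-gap k) , proj₂ (γ∈H⁻ k))
  ; subpath = λ j i loP≤i i≤hiP → black∈H⁻⁺ j (subst (_≤ toℕ i) (loP≡boundary j) loP≤i , i≤hiP)
  ; leaves = leaf
  ; no-other-edges = tree-edge
  }
  where
    open BlockCutTree E red-nbr (≤-trans (n≤1+n 2) 3≤m)
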